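{- Let $G=(V,E)$ be a graph and $k$ an integer. Then $G$ has a dominating set of size $k$ if and only if it is possible to turn $G$ into a constellation by deleting $|E|-|V|+k$ edges.
   Context: All graphs are finite, simple and undirected. A dominating set of $G$ is a set $D\subseteq V$ such that every vertex of $V\setminus D$ is adjacent to some vertex of $D$. A star is a complete bipartite graph $K_{1,n}$ for some $n\ge 0$ (so a single vertex is a star). A constellation is a forest each of whose connected components is a star. Deleting edges does not delete vertices. -}

module Defs where

open import Data.Nat using (ℕ; zero; suc; _+_; _<ᵇ_)
open import Data.Fin using (Fin; toℕ)
open import Data.Fin.Subset using (Subset; _∈_; _∉_; ∣_∣)
open import Data.Nat.ListAction using (sum)
open import Data.List using (List; map; cartesianProductWith; allFin)
open import Data.Bool using (Bool; true; false; _∧_; if_then_else_)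
open import Data.Product using (Σ; ∃; _×_; _,_)
open import Relation.Binary.PropositionalEquality using (_≡_; _≢_)

record Graph (n : ℕ) : Set where
  field
    adj   : Fin n → Fin n → Bool
    sym   : ∀ u v → adj u v ≡ adj v u
    irrefl : ∀ v → adj v v ≡ false
open Graph public

Adj : ∀ {n} → Graph n → Fin n → Fin n → Set
Adj G u v = adj G u v ≡ true

edgeCount : ∀ {n} → Graph n → ℕ
edgeCount {n} G =
  sum (cartesianProductWith
         (λ u v → if (toℕ u <ᵇ toℕ v) ∧ adj G u v then 1 else 0)
         (allFin n) (allFin n))

IsDominating : ∀ {n} → Graph n → Subset n → Set
IsDominating {n} G D = ∀ (v : Fin n) → v ∉ D → ∃ λ u → u ∈ D × Adj G u v

-- H is obtained from G by deleting edges (spanning subgraph, same vertices).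
IsSpanningSubgraph : ∀ {n} → Graph n → Graph n → Set
IsSpanningSubgraph {n} H G = ∀ (u v : Fin n) → Adj H u v → Adj G u v

data Reach {n : ℕ} (G : Graph n) : Fin n → Fin n → Set where
  here : ∀ {v} → Reach G v v
  step : ∀ {u w v} → Adj G u w → Reach G w v → Reach G u v

-- The connected component containing x is a star K_{1,m} (m ≥ 0):
-- it has a centre c adjacent to every other vertex of the component,
-- and no edge of the component joins two non-centre vertices.
ComponentIsStar : ∀ {n} → Graph n → Fin n → Set
ComponentIsStar {n} G x =
  Σ (Fin n) λ c → Reach G x c ×
    ((∀ (v : Fin n) → Reach G x v → v ≢ c → Adj G c v) ×
     (∀ (u v : Fin n) → Reach G x u → Reach G x v →
        u ≢ c → v ≢ c → Adj G u v → Data.Empty.⊥))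
  where import Data.Empty

IsConstellation : ∀ {n} → Graph n → Set
IsConstellation {n} G = ∀ (x : Fin n) → ComponentIsStar G x

module Submission where

-- If D dominates G, hang every vertex outside D on one of its neighbours in D:
-- the result is a spanning constellation whose stars are centred at the
-- vertices of D, with exactly one edge per leaf, hence n - |D| edges.
-- Conversely, in a constellation choose one centre in every star (for a
-- component K₂ the end with the smaller index); the centres dominate G, and
-- since every edge has exactly one leaf end and every leaf exactly one edge,
-- the constellation has n - #centres edges.  In both directions the number of
-- deleted edges is therefore |E| - n + |D|.

module Constellations where

  open import Defs hiding (sym)
  open import Data.Bool using (Bool; true; false; not; _∧_; _∨_; if_then_else_)
  import Data.Bool as Bool using (_≟_)
  open import Data.Bool.Properties
    using (∧-zeroʳ; ∧-identityʳ; ∨-comm; not-involutive; not-injective)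
  open import Data.Empty using (⊥; ⊥-elim)
  open import Data.Fin using (Fin; toℕ; punchIn; _≟_) renaming (zero to fzero; suc to fsuc)
  open import Data.Fin.Properties using (punchInᵢ≢i; toℕ-injective; all?; any?)
  open import Data.Fin.Subset using (Subset; ∣_∣; ∁; _∉_)
  open import Data.Fin.Subset.Properties using (∣∁p∣≡n∸∣p∣; ∣p∣≤n)
  open import Data.List using (List; []; _∷_; map; cartesianProductWith; allFin)
  import Data.List as List using (tabulate; _++_)
  open import Data.List.Properties using (map-tabulate)
  open import Data.Nat using (ℕ; zero; suc; _+_; _*_; _∸_; _<ᵇ_; _<_; _<?_)
  open import Data.Nat.Properties
    using (+-0-commutativeMonoid; +-identityʳ; *-cancelˡ-≡; m∸n+n≡m; <-cmp; <-asym)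
  import Data.Nat.ListAction as ListAction
  open import Data.Nat.ListAction.Properties using (sum-++)
  open import Data.Product using (Σ; ∃; _×_; _,_; proj₁; proj₂)
  open import Data.Sum using (_⊎_; inj₁; inj₂)
  import Data.Sum as Sum using (swap)
  open import Data.Vec using (lookup; tabulate; []; _∷_)
  open import Data.Vec.Properties using (lookup-map; []=⇒lookup; lookup⇒[]=; lookup∘tabulate)
  open import Function using (_∘_)
  open import Relation.Binary using (tri<; tri≈; tri>)
  open import Relation.Binary.PropositionalEquality
  open import Relation.Nullary using (¬_; contradiction; Dec; does; yes; no)
  open import Relation.Nullary.Decidable using (dec-true; _×-dec_; _⊎-dec_; _→-dec_; ¬?)
  open import Algebra.Properties.CommutativeMonoid.Sum +-0-commutativeMonoid
    using (sum; sum-syntax; sum-cong-≗; sum-replicate-zero; sum-remove; ∑-comm; ∑-distrib-+)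
  open ≡-Reasoning

  adj-irrefl : ∀ {n} (H : Graph n) {u v} → Adj H u v → u ≢ v
  adj-irrefl H {u} uv refl with trans (sym uv) (irrefl H u)
  ... | ()

  Reach-snoc : ∀ {n} {H : Graph n} {x u w} → Reach H x u → Adj H u w → Reach H x w
  Reach-snoc here       uw = step uw here
  Reach-snoc (step e r) uw = step e (Reach-snoc r uw)

  lookup-false⇒∉ : ∀ {n} {D : Subset n} {v} → lookup D v ≡ false → v ∉ D
  lookup-false⇒∉ Dv v∈D with trans (sym ([]=⇒lookup v∈D)) Dv
  ... | ()

  ∉⇒lookup-false : ∀ {n} {D : Subset n} {v} → v ∉ D → lookup D v ≡ false
  ∉⇒lookup-false {D = D} {v} v∉D with lookup D v in Dv
  ... | true  = contradiction (lookup⇒[]= v D Dv) v∉D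
  ... | false = refl

  does-exclusive : ∀ {P Q : Set} (p : Dec P) (q : Dec Q) →
    P ⊎ Q → ¬ (P × Q) → does p ≡ not (does q)
  does-exclusive (yes _) (no _)  _         _ = refl
  does-exclusive (no _)  (yes _) _         _ = refl
  does-exclusive (yes a) (yes b) _         ¬both = contradiction (a , b) ¬both
  does-exclusive (no ¬a) (no ¬b) (inj₁ a) _ = contradiction a ¬a
  does-exclusive (no ¬a) (no ¬b) (inj₂ b) _ = contradiction b ¬b

  indicator : Bool → ℕ
  indicator b = if b then 1 else 0

  sum-tabulate : ∀ {n} (f : Fin n → ℕ) → ListAction.sum (List.tabulate f) ≡ sum f
  sum-tabulate {zero}  f = refl
  sum-tabulate {suc n} f = cong (f fzero +_) (sum-tabulate (f ∘ fsuc))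

  sum-map-allFin : ∀ {n} (f : Fin n → ℕ) → ListAction.sum (map f (allFin n)) ≡ sum f
  sum-map-allFin {n} f = trans (cong ListAction.sum (map-tabulate (λ i → i) f)) (sum-tabulate f)

  sum-cartesianProductWith : ∀ {A B : Set} (g : A → B → ℕ) (xs : List A) (ys : List B) →
    ListAction.sum (cartesianProductWith g xs ys) ≡
    ListAction.sum (map (λ x → ListAction.sum (map (g x) ys)) xs)
  sum-cartesianProductWith g []       ys = refl
  sum-cartesianProductWith g (x ∷ xs) ys = begin
    ListAction.sum (map (g x) ys List.++ cartesianProductWith g xs ys)
      ≡⟨ sum-++ (map (g x) ys) _ ⟩
    ListAction.sum (map (g x) ys) + ListAction.sum (cartesianProductWith g xs ys)
      ≡⟨ cong (ListAction.sum (map (g x) ys) +_) (sum-cartesianProductWith g xs ys) ⟩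
    ListAction.sum (map (g x) ys) + ListAction.sum (map (λ x → ListAction.sum (map (g x) ys)) xs)
      ∎

  edgeCount≡∑∑ : ∀ {n} (G : Graph n) →
    edgeCount G ≡ ∑[ u < n ] ∑[ v < n ] indicator ((toℕ u <ᵇ toℕ v) ∧ adj G u v)
  edgeCount≡∑∑ {n} G = begin
    edgeCount G
      ≡⟨ sum-cartesianProductWith row (allFin n) (allFin n) ⟩
    ListAction.sum (map (λ u → ListAction.sum (map (row u) (allFin n))) (allFin n))
      ≡⟨ sum-map-allFin (λ u → ListAction.sum (map (row u) (allFin n))) ⟩
    ∑[ u < n ] ListAction.sum (map (row u) (allFin n))
      ≡⟨ sum-cong-≗ (λ u → sum-map-allFin (row u)) ⟩
    ∑[ u < n ] ∑[ v < n ] row u v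
      ∎
    where
    row : Fin n → Fin n → ℕ
    row u v = indicator ((toℕ u <ᵇ toℕ v) ∧ adj G u v)

  ∑-indicator-false : ∀ {n} (f : Fin n → Bool) → (∀ w → f w ≡ false) →
    ∑[ w < n ] indicator (f w) ≡ 0
  ∑-indicator-false {n} f none = trans (sum-cong-≗ (cong indicator ∘ none)) (sum-replicate-zero n)

  ∑-indicator-unique : ∀ {n} (f : Fin n → Bool) {v : Fin n} → f v ≡ true →
    (∀ w → f w ≡ true → w ≡ v) → ∑[ w < n ] indicator (f w) ≡ 1
  ∑-indicator-unique {suc n} f {v} fv≡true unique = begin
    sum (indicator ∘ f)
      ≡⟨ sum-remove {i = v} (indicator ∘ f) ⟩
    indicator (f v) + sum (indicator ∘ f ∘ punchIn v)
      ≡⟨ cong₂ _+_ (cong indicator fv≡true) (∑-indicator-false (f ∘ punchIn v) elsewhere) ⟩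
    1 ∎
    where
    elsewhere : ∀ w → f (punchIn v w) ≡ false
    elsewhere w with f (punchIn v w) in fw
    ... | true  = contradiction (unique _ fw) (punchInᵢ≢i v w)
    ... | false = refl

  ∑∑-twice : ∀ {n} (f : Fin n → Fin n → ℕ) →
    ∑[ u < n ] ∑[ v < n ] f u v + ∑[ u < n ] ∑[ v < n ] f u v ≡
    ∑[ u < n ] ∑[ v < n ] (f u v + f v u)
  ∑∑-twice {n} f = begin
    ∑[ u < n ] ∑[ v < n ] f u v + ∑[ u < n ] ∑[ v < n ] f u v
      ≡⟨ cong (∑[ u < n ] ∑[ v < n ] f u v +_) (∑-comm f) ⟩
    ∑[ u < n ] ∑[ v < n ] f u v + ∑[ u < n ] ∑[ v < n ] f v u
      ≡⟨ ∑-distrib-+ (λ u → ∑[ v < n ] f u v) (λ u → ∑[ v < n ] f v u) ⟨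
    ∑[ u < n ] (∑[ v < n ] f u v + ∑[ v < n ] f v u)
      ≡⟨ sum-cong-≗ (λ u → ∑-distrib-+ (f u) (λ v → f v u)) ⟨
    ∑[ u < n ] ∑[ v < n ] (f u v + f v u)
      ∎

  x+x≡y+y⇒x≡y : ∀ {x y} → x + x ≡ y + y → x ≡ y
  x+x≡y+y⇒x≡y {x} {y} eq = *-cancelˡ-≡ x y 2 (begin
    2 * x    ≡⟨ cong (x +_) (+-identityʳ x) ⟩
    x + x    ≡⟨ eq ⟩
    y + y    ≡⟨ cong (y +_) (+-identityʳ y) ⟨
    2 * y    ∎)

  ∑∑-cong-symmetrised : ∀ {n} (f g : Fin n → Fin n → ℕ) →
    (∀ u v → f u v + f v u ≡ g u v + g v u) →
    ∑[ u < n ] ∑[ v < n ] f u v ≡ ∑[ u < n ] ∑[ v < n ] g u v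
  ∑∑-cong-symmetrised f g f≈g = x+x≡y+y⇒x≡y (begin
    _ ≡⟨ ∑∑-twice f ⟩
    _ ≡⟨ sum-cong-≗ (λ u → sum-cong-≗ (f≈g u)) ⟩
    _ ≡⟨ ∑∑-twice g ⟨
    _ ∎)

  ∣p∣≡∑indicator : ∀ {n} (p : Subset n) → ∣ p ∣ ≡ ∑[ u < n ] indicator (lookup p u)
  ∣p∣≡∑indicator []          = refl
  ∣p∣≡∑indicator (true ∷ p)  = cong suc (∣p∣≡∑indicator p)
  ∣p∣≡∑indicator (false ∷ p) = ∣p∣≡∑indicator p

  indicator-complementary : ∀ {a b} → a ≡ not b → indicator a + indicator b ≡ 1
  indicator-complementary {b = true}  refl = refl
  indicator-complementary {b = false} refl = refl

  indicator-<ᵇ-connex : ∀ m n → m ≢ n → indicator (m <ᵇ n) + indicator (n <ᵇ m) ≡ 1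
  indicator-<ᵇ-connex zero    zero    m≢n = contradiction refl m≢n
  indicator-<ᵇ-connex zero    (suc n) m≢n = refl
  indicator-<ᵇ-connex (suc m) zero    m≢n = refl
  indicator-<ᵇ-connex (suc m) (suc n) m≢n = indicator-<ᵇ-connex m n (m≢n ∘ cong suc)

  indicator-∧-split : ∀ x y e → (e ≡ true → indicator x + indicator y ≡ 1) →
    indicator (x ∧ e) + indicator (y ∧ e) ≡ indicator e
  indicator-∧-split x y false _   rewrite ∧-zeroʳ x     | ∧-zeroʳ y     = refl
  indicator-∧-split x y true  one rewrite ∧-identityʳ x | ∧-identityʳ y = one refl

  Pendant : ∀ {n} → Graph n → Fin n → Fin n → Set
  Pendant H u v = Adj H u v × (∀ w → Adj H u w → w ≡ v)

  -- H is a disjoint union of stars centred at the vertices of C.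
  record IsCentreSet {n} (H : Graph n) (C : Subset n) : Set where
    field
      crossing      : ∀ u v → Adj H u v → lookup C u ≡ not (lookup C v)
      leaf-pendant : ∀ u → lookup C u ≡ false → ∃ (Pendant H u)

  module _ {n} {H : Graph n} {C : Subset n} (centres : IsCentreSet H C) where
    open IsCentreSet centres

    private
      leaf : Fin n → Bool
      leaf u = not (lookup C u)

      ordered-edge : Fin n → Fin n → ℕ
      ordered-edge u v = indicator ((toℕ u <ᵇ toℕ v) ∧ adj H u v)

      leaf-edge : Fin n → Fin n → ℕ
      leaf-edge u v = indicator (leaf u ∧ adj H u v)

      -- An edge is counted once from its smaller end, and once from its leaf end.
      each-edge-once : ∀ u v → ordered-edge u v + ordered-edge v u ≡ leaf-edge u v + leaf-edge v u
      each-edge-once u v rewrite Graph.sym H v u = begin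
        ordered-edge u v + indicator ((toℕ v <ᵇ toℕ u) ∧ adj H u v)
          ≡⟨ indicator-∧-split (toℕ u <ᵇ toℕ v) (toℕ v <ᵇ toℕ u) (adj H u v)
               (λ uv → indicator-<ᵇ-connex _ _ (adj-irrefl H uv ∘ toℕ-injective)) ⟩
        indicator (adj H u v)
          ≡⟨ indicator-∧-split (leaf u) (leaf v) (adj H u v)
               (λ uv → indicator-complementary (cong not (crossing u v uv))) ⟨
        leaf-edge u v + indicator (leaf v ∧ adj H u v)
          ∎

      leaf-degree : ∀ u → ∑[ v < n ] leaf-edge u v ≡ indicator (leaf u)
      leaf-degree u with lookup C u in Cu
      ... | true  = ∑-indicator-false {n} (λ _ → false) (λ _ → refl)
      ... | false with leaf-pendant u Cu
      ... | v , uv , unique = ∑-indicator-unique (adj H u) uv unique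

    edgeCount≡∣∁C∣ : edgeCount H ≡ ∣ ∁ C ∣
    edgeCount≡∣∁C∣ = begin
      edgeCount H
        ≡⟨ edgeCount≡∑∑ H ⟩
      ∑[ u < n ] ∑[ v < n ] ordered-edge u v
        ≡⟨ ∑∑-cong-symmetrised ordered-edge leaf-edge each-edge-once ⟩
      ∑[ u < n ] ∑[ v < n ] leaf-edge u v
        ≡⟨ sum-cong-≗ leaf-degree ⟩
      ∑[ u < n ] indicator (leaf u)
        ≡⟨ sum-cong-≗ (λ u → cong indicator (lookup-map u not C)) ⟨
      ∑[ u < n ] indicator (lookup (∁ C) u)
        ≡⟨ ∣p∣≡∑indicator (∁ C) ⟨
      ∣ ∁ C ∣
        ∎

    edgeCount+∣C∣≡n : edgeCount H + ∣ C ∣ ≡ n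
    edgeCount+∣C∣≡n = begin
      edgeCount H + ∣ C ∣     ≡⟨ cong (_+ ∣ C ∣) (trans edgeCount≡∣∁C∣ (∣∁p∣≡n∸∣p∣ C)) ⟩
      (n ∸ ∣ C ∣) + ∣ C ∣     ≡⟨ m∸n+n≡m (∣p∣≤n C) ⟩
      n                       ∎

  module Attachment {n} (D : Subset n) (centreOf : Fin n → Fin n)
    (centreOf-∈ : ∀ v → lookup D (centreOf v) ≡ true)
    (centreOf-fixes : ∀ v → lookup D v ≡ true → centreOf v ≡ v) where

    Attached : Fin n → Fin n → Set
    Attached a b = lookup D a ≡ false × centreOf a ≡ b

    attached : Fin n → Fin n → Bool
    attached a b = not (lookup D a) ∧ does (centreOf a ≟ b)

    attached-true : ∀ {a b} → attached a b ≡ true → Attached a b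
    attached-true {a} {b} eq with lookup D a | centreOf a ≟ b
    attached-true ()  | true  | _
    attached-true ()  | false | no _
    attached-true eq  | false | yes c≡b = refl , c≡b

    Attached-centre : ∀ {a b} → Attached a b → lookup D b ≡ true
    Attached-centre {a} (_ , refl) = centreOf-∈ a

    Attached-irrefl : ∀ {a} → ¬ Attached a a
    Attached-irrefl aa with trans (sym (proj₁ aa)) (Attached-centre aa)
    ... | ()

    attached-irrefl : ∀ a → attached a a ≡ false
    attached-irrefl a with attached a a in aa
    ... | true  = contradiction (attached-true aa) Attached-irrefl
    ... | false = refl

    stars : Graph n
    stars = record
      { adj    = λ a b → attached a b ∨ attached b a
      ; sym    = λ a b → ∨-comm (attached a b) (attached b a)
      ; irrefl = λ a → cong (λ x → x ∨ x) (attached-irrefl a)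
      }

    Adj⇒Attached : ∀ {a b} → Adj stars a b → Attached a b ⊎ Attached b a
    Adj⇒Attached {a} {b} eq with attached a b in ab
    ... | true  = inj₁ (attached-true ab)
    ... | false = inj₂ (attached-true eq)

    Attached⇒Adj : ∀ {a b} → Attached a b → Adj stars a b
    Attached⇒Adj {a} (Da , refl) rewrite Da | dec-true (centreOf a ≟ centreOf a) refl = refl

    Attached⇒centreOf≡ : ∀ {a b} → Attached a b → centreOf a ≡ centreOf b
    Attached⇒centreOf≡ {b = b} ab@(_ , c≡b) =
      trans c≡b (sym (centreOf-fixes b (Attached-centre ab)))

    Reach⇒centreOf≡ : ∀ {a b} → Reach stars a b → centreOf a ≡ centreOf b
    Reach⇒centreOf≡ here       = refl
    Reach⇒centreOf≡ (step e r) with Adj⇒Attached e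
    ... | inj₁ ab = trans (Attached⇒centreOf≡ ab) (Reach⇒centreOf≡ r)
    ... | inj₂ ba = trans (sym (Attached⇒centreOf≡ ba)) (Reach⇒centreOf≡ r)

    off-centre-attached : ∀ v → v ≢ centreOf v → Attached v (centreOf v)
    off-centre-attached v v≢c with lookup D v in Dv
    ... | true  = contradiction (sym (centreOf-fixes v Dv)) v≢c
    ... | false = refl , refl

    reach-centre : ∀ v → Reach stars v (centreOf v)
    reach-centre v with v ≟ centreOf v
    ... | yes v≡c = subst (Reach stars v) v≡c here
    ... | no  v≢c = step (Attached⇒Adj (off-centre-attached v v≢c)) here

    stars-constellation : IsConstellation stars
    stars-constellation x = centreOf x , reach-centre x , spoke , no-rim
      where
      c≡ : ∀ {v} → Reach stars x v → centreOf v ≡ centreOf x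
      c≡ r = sym (Reach⇒centreOf≡ r)

      spoke : ∀ v → Reach stars x v → v ≢ centreOf x → Adj stars (centreOf x) v
      spoke v r v≢c = subst (λ c → Adj stars c v) (c≡ r)
        (trans (Graph.sym stars _ v) (Attached⇒Adj (off-centre-attached v v≢cv)))
        where
        v≢cv : v ≢ centreOf v
        v≢cv v≡cv = v≢c (trans v≡cv (c≡ r))

      no-rim : ∀ u v → Reach stars x u → Reach stars x v →
               u ≢ centreOf x → v ≢ centreOf x → Adj stars u v → ⊥
      no-rim u v ru rv u≢c v≢c e with Adj⇒Attached e
      ... | inj₁ (_ , cu≡v) = v≢c (trans (sym cu≡v) (c≡ ru))
      ... | inj₂ (_ , cv≡u) = u≢c (trans (sym cv≡u) (c≡ rv))

    stars-centres : IsCentreSet stars D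
    stars-centres = record { crossing = crossing ; leaf-pendant = leaf-pendant }
      where
      leaf-to-centre : ∀ {a b} → Attached a b → lookup D a ≡ not (lookup D b)
      leaf-to-centre ab@(Da , _) = trans Da (cong not (sym (Attached-centre ab)))

      crossing : ∀ u v → Adj stars u v → lookup D u ≡ not (lookup D v)
      crossing u v e with Adj⇒Attached e
      ... | inj₁ uv = leaf-to-centre uv
      ... | inj₂ vu = trans (sym (not-involutive _)) (cong not (sym (leaf-to-centre vu)))

      leaf-pendant : ∀ u → lookup D u ≡ false → ∃ (Pendant stars u)
      leaf-pendant u Du = centreOf u , Attached⇒Adj (Du , refl) , unique
        where
        unique : ∀ w → Adj stars u w → w ≡ centreOf u
        unique w e with Adj⇒Attached e
        ... | inj₁ (_ , cu≡w) = sym cu≡w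
        ... | inj₂ wu with trans (sym Du) (Attached-centre wu)
        ... | ()

    stars-spanning : ∀ {G : Graph n} → (∀ v → lookup D v ≡ false → Adj G (centreOf v) v) →
      IsSpanningSubgraph stars G
    stars-spanning {G} centre-adj u v e with Adj⇒Attached e
    ... | inj₁ (Du , refl) = trans (Graph.sym G u (centreOf u)) (centre-adj u Du)
    ... | inj₂ (Dv , refl) = centre-adj v Dv

  module _ {n} {G : Graph n} {D : Subset n} (dominating : IsDominating G D) where

    private
      Dominates : Fin n → Fin n → Set
      Dominates v c =
        lookup D c ≡ true × (lookup D v ≡ true → c ≡ v) × (lookup D v ≡ false → Adj G c v)

      dominator : ∀ v → ∃ (Dominates v)
      dominator v with lookup D v in Dv
      ... | true  = v , Dv , (λ _ → refl) , λ ()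
      ... | false with dominating v (lookup-false⇒∉ Dv)
      ... | c , c∈D , cv = c , []=⇒lookup c∈D , (λ ()) , λ _ → cv

      open Attachment D (proj₁ ∘ dominator) (proj₁ ∘ proj₂ ∘ dominator)
                        (proj₁ ∘ proj₂ ∘ proj₂ ∘ dominator)

    dominating⇒constellation : Σ (Graph n) λ H →
      IsSpanningSubgraph H G × IsConstellation H × IsCentreSet H D
    dominating⇒constellation =
      stars , stars-spanning {G} (proj₂ ∘ proj₂ ∘ proj₂ ∘ dominator) ,
      stars-constellation , stars-centres

  module _ {n} (H : Graph n) where

    off-centre-pendant : ∀ {x u} → ((c , _) : ComponentIsStar H x) →
      Reach H x u → u ≢ c → Pendant H u c
    off-centre-pendant {u = u} (c , _ , spoke , no-rim) xu u≢c =
      trans (Graph.sym H u c) (spoke u xu u≢c) , unique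
      where
      unique : ∀ w → Adj H u w → w ≡ c
      unique w uw with w ≟ c
      ... | yes w≡c = w≡c
      ... | no  w≢c = ⊥-elim (no-rim u w xu (Reach-snoc xu uw) u≢c w≢c uw)

    pendant-end : IsConstellation H → ∀ {u v} → Adj H u v → Pendant H u v ⊎ Pendant H v u
    pendant-end stars {u} {v} uv with stars u | u ≟ proj₁ (stars u)
    ... | star@(c , _) | yes refl =
      inj₂ (off-centre-pendant star (step uv here) (adj-irrefl H uv ∘ sym))
    ... | star@(c , _) | no u≢c with off-centre-pendant star here u≢c
    ... | uc@(_ , unique) with unique v uv
    ... | refl = inj₁ uc

    -- In a star with at least two leaves the centre is the only vertex of degree
    -- at least two; in a component K₂ the tie is broken by the vertex index.
    Leaf : Fin n → Set
    Leaf u = ∃ λ v → Pendant H u v × (¬ Pendant H v u ⊎ toℕ v < toℕ u)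

    pendant? : ∀ u v → Dec (Pendant H u v)
    pendant? u v = adj? u v ×-dec all? (λ w → adj? u w →-dec (w ≟ v))
      where
      adj? : ∀ u v → Dec (Adj H u v)
      adj? u v = adj H u v Bool.≟ true

    leaf? : ∀ u → Dec (Leaf u)
    leaf? u = any? (λ v → pendant? u v ×-dec (¬? (pendant? v u) ⊎-dec (toℕ v <? toℕ u)))

    not-both-leaves : ∀ {u v} → Adj H u v → Leaf u → Leaf v → ⊥
    not-both-leaves uv (_ , pu@(_ , u-unique) , u-tie) (_ , pv@(_ , v-unique) , v-tie)
      with u-unique _ uv | v-unique _ (trans (Graph.sym H _ _) uv)
    ... | refl | refl with u-tie | v-tie
    ... | inj₁ ¬pv | _         = ¬pv pv
    ... | _        | inj₁ ¬pu  = ¬pu pu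
    ... | inj₂ v<u | inj₂ u<v  = <-asym v<u u<v

    pendant-leaf : ∀ {u v} → Pendant H u v → Leaf u ⊎ Leaf v
    pendant-leaf {u} {v} pu with pendant? v u
    ... | no ¬pv = inj₁ (v , pu , inj₁ ¬pv)
    ... | yes pv with <-cmp (toℕ v) (toℕ u)
    ... | tri< v<u _ _ = inj₁ (v , pu , inj₂ v<u)
    ... | tri> _ _ u<v = inj₂ (u , pv , inj₂ u<v)
    ... | tri≈ _ v≡u _ = ⊥-elim (adj-irrefl H (proj₁ pu) (sym (toℕ-injective v≡u)))

    starCentres : Subset n
    starCentres = tabulate (λ u → not (does (leaf? u)))

    constellation-centres : IsConstellation H → IsCentreSet H starCentres
    constellation-centres stars = record { crossing = crossing ; leaf-pendant = leaf-pendant }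
      where
      lookup-starCentres : ∀ u → lookup starCentres u ≡ not (does (leaf? u))
      lookup-starCentres = lookup∘tabulate _

      crossing : ∀ u v → Adj H u v → lookup starCentres u ≡ not (lookup starCentres v)
      crossing u v uv rewrite lookup-starCentres u | lookup-starCentres v =
        cong not (does-exclusive (leaf? u) (leaf? v) some-leaf
                   (λ (lu , lv) → not-both-leaves uv lu lv))
        where
        some-leaf : Leaf u ⊎ Leaf v
        some-leaf with pendant-end stars uv
        ... | inj₁ pu = pendant-leaf pu
        ... | inj₂ pv = Sum.swap (pendant-leaf pv)

      leaf-pendant : ∀ u → lookup starCentres u ≡ false → ∃ (Pendant H u)
      leaf-pendant u Cu rewrite lookup-starCentres u with leaf? u
      ... | yes (v , pu , _) = v , pu

  centres-dominate : ∀ {n} {G H : Graph n} {C : Subset n} →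
    IsSpanningSubgraph H G → IsCentreSet H C → IsDominating G C
  centres-dominate {n} {H = H} {C} H⊆G centres v v∉C =
    p , lookup⇒[]= p C Cp , H⊆G p v (trans (Graph.sym H p v) vp)
    where
    open IsCentreSet centres
    Cv : lookup C v ≡ false
    Cv = ∉⇒lookup-false v∉C
    p : Fin n
    p = proj₁ (leaf-pendant v Cv)
    vp : Adj H v p
    vp = proj₁ (proj₂ (leaf-pendant v Cv))
    Cp : lookup C p ≡ true
    Cp = not-injective (trans (sym (crossing v p vp)) Cv)

open import Defs hiding (sym)
open import Data.Nat using (ℕ)
open import Data.Integer using (ℤ; +_; _+_; _-_)
open import Data.Fin.Subset using (Subset; ∣_∣)
open import Data.Product using (Σ; _×_; _,_)
open import Function.Bundles using (_⇔_; mk⇔; Equivalence)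
open import Relation.Binary.PropositionalEquality using (_≡_; refl; sym; trans)
import Data.Nat as ℕ
open import Data.Integer.Properties using (pos-+; +-0-abelianGroup)
open import Algebra.Bundles using (AbelianGroup)
open import Algebra.Properties.Group (AbelianGroup.group +-0-abelianGroup) using (∙-cancelˡ)
open import Data.Integer.Tactic.RingSolver using (solve-∀)
open Constellations
  using ( IsCentreSet; edgeCount+∣C∣≡n; dominating⇒constellation
        ; starCentres; constellation-centres; centres-dominate )

shift-sub : ∀ (a b c : ℤ) → a - b ≡ a - (b + c) + c
shift-sub = solve-∀

deleted-edges⇔ : ∀ e {m d n} k → m ℕ.+ d ≡ n → (+ d ≡ k) ⇔ (+ e - + m ≡ + e - + n + k)
deleted-edges⇔ e {m} {d} k refl = mk⇔ to from
  where
  shifted : + e - + m ≡ + e - + (m ℕ.+ d) + + d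
  shifted rewrite pos-+ m d = shift-sub (+ e) (+ m) (+ d)

  to : + d ≡ k → + e - + m ≡ + e - + (m ℕ.+ d) + k
  to refl = shifted

  from : + e - + m ≡ + e - + (m ℕ.+ d) + k → + d ≡ k
  from eq = ∙-cancelˡ (+ e - + (m ℕ.+ d)) (+ d) k (trans (sym shifted) eq)

mainTheorem4 : ∀ (n : ℕ) (G : Graph n) (k : ℤ) →
    (Σ (Subset n) λ D → IsDominating G D × (+ ∣ D ∣ ≡ k))
    ⇔
    (Σ (Graph n) λ H → IsSpanningSubgraph H G × IsConstellation H ×
       (+ edgeCount G - + edgeCount H ≡ + edgeCount G - + n + k))
mainTheorem4 n G k = mk⇔
  (λ (D , dominating , ∣D∣≡k) →
     let H , H⊆G , stars , centres = dominating⇒constellation {G = G} dominating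
     in  H , H⊆G , stars , Equivalence.to (deletion-count centres) ∣D∣≡k)
  (λ (H , H⊆G , stars , deleted) →
     let centres = constellation-centres H stars
     in  starCentres H , centres-dominate {G = G} H⊆G centres ,
         Equivalence.from (deletion-count centres) deleted)
  where
  deletion-count : ∀ {H C} → IsCentreSet H C →
    (+ ∣ C ∣ ≡ k) ⇔ (+ edgeCount G - + edgeCount H ≡ + edgeCount G - + n + k)
  deletion-count centres = deleted-edges⇔ (edgeCount G) k (edgeCount+∣C∣≡n centres)
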